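{- Let $\mathcal H=(V,\mathcal E)$ and $\mathcal H'=(V',\mathcal E')$ be hypergraphs with $V=\{1,\dots,n\}$ and $V'=\{1,\dots,m\}$. Then $\mathcal H\preceq\mathcal H'$ if and only if $f_{\mathcal H}\le f_{\mathcal H'}$.
   Context: A hypergraph $\mathcal H=(V,\mathcal E)$ consists of a finite nonempty set $V$ and a collection $\mathcal E$ of subsets of $V$ (hyperedges; the empty set may be a hyperedge). For $V=\{1,\dots,n\}$, $f_{\mathcal H}\colon\{0,1\}^n\to\{0,1\}$ is the function computed by the polynomial over $GF(2)$ given by $\sum_{E\in\mathcal E}\prod_{i\in E}x_i$ (empty product $=1$). A map $h'\colon V'\to V$ is a quotient map from $\mathcal H'=(V',\mathcal E')$ to $\mathcal H=(V,\mathcal E)$ if for every $E\subseteq V$: $E\in\mathcal E$ iff the number of $E'\in\mathcal E'$ with $h'(E')=E$ is odd (where $h'(E')=\{h'(i):i\in E'\}$). Write $\mathcal H\preceq\mathcal H'$ if there is a quotient map from $\mathcal H'$ to $\mathcal H$. For Boolean functions $g$ of arity $m$ and $f$ of arity $n$, $g\le f$ means there is $\sigma\colon\{1,\dots,n\}\to\{1,\dots,m\}$ with $g(a_1,\dots,a_m)=f(a_{\sigma(1)},\dots,a_{\sigma(n)})$ for all $a_i\in\{0,1\}$. -}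

module Defs where

open import Data.Nat using (ℕ; zero; suc; _+_; _%_; _≡ᵇ_)
open import Data.Bool using (Bool; true; false; _∧_; _∨_; not; _xor_; if_then_else_)
open import Data.Fin using (Fin)
open import Data.Fin.Properties using () renaming (_≟_ to _≟ᶠ_)
open import Data.Fin.Subset using (Subset)
open import Data.Vec using (Vec; []; _∷_; lookup; tabulate)
open import Data.Vec.Properties using (≡-dec)
open import Data.List using (List; []; _∷_; map; _++_; foldr; allFin)
open import Data.Nat.ListAction using (sum)
open import Data.Bool.ListAction using (any; all)
open import Data.Product using (∃; _,_)
open import Relation.Nullary.Decidable using (⌊_⌋)
open import Relation.Binary.PropositionalEquality using (_≡_)
import Data.Bool.Properties as BoolP

allSubsets : (n : ℕ) → List (Subset n)
allSubsets zero = [] ∷ []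
allSubsets (suc n) = map (false ∷_) (allSubsets n) ++ map (true ∷_) (allSubsets n)

_==ˢ_ : ∀ {n} → Subset n → Subset n → Bool
A ==ˢ B = ⌊ ≡-dec BoolP._≟_ A B ⌋

-- Any collection of subsets (including ∅) is allowed.
record Hypergraph (n : ℕ) : Set where
  field
    edges : Subset n → Bool
open Hypergraph public

image : ∀ {m n} → (Fin m → Fin n) → Subset m → Subset n
image {m} h E' = tabulate λ i → any (λ j → lookup E' j ∧ ⌊ h j ≟ᶠ i ⌋) (allFin m)

countPreimages : ∀ {m n} → Hypergraph m → (Fin m → Fin n) → Subset n → ℕ
countPreimages {m} H' h E =
  sum (map (λ E' → if edges H' E' ∧ (image h E' ==ˢ E) then 1 else 0) (allSubsets m))

IsQuotientMap : ∀ {m n} → Hypergraph m → Hypergraph n → (Fin m → Fin n) → Set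
IsQuotientMap H' H h =
  ∀ E → edges H E ≡ (countPreimages H' h E % 2 ≡ᵇ 1)

_⪯_ : ∀ {n m} → Hypergraph n → Hypergraph m → Set
_⪯_ {n} {m} H H' = ∃ λ (h : Fin m → Fin n) → IsQuotientMap H' H h

monomial : ∀ {n} → Subset n → (Fin n → Bool) → Bool
monomial {n} E a = all (λ i → not (lookup E i) ∨ a i) (allFin n)

fH : ∀ {n} → Hypergraph n → (Fin n → Bool) → Bool
fH {n} H a = foldr _xor_ false (map (λ E → edges H E ∧ monomial E a) (allSubsets n))

_≤ᶠ_ : ∀ {m n} → ((Fin m → Bool) → Bool) → ((Fin n → Bool) → Bool) → Set
_≤ᶠ_ {m} {n} g f = ∃ λ (σ : Fin n → Fin m) → ∀ (a : Fin m → Bool) → g a ≡ f (λ i → a (σ i))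

-- Substituting x_{h j} for x_j sends the monomial of E' to the monomial of h(E'), so
-- f_{H'}(a ∘ h) is the polynomial of the hypergraph on V whose edges are the E with an
-- odd number of h-preimages in 𝓔' (terms cancel in pairs over GF(2)).  A Boolean function
-- has a unique algebraic normal form, so f_H = f_{H'} ∘ h holds exactly when H is that
-- hypergraph, i.e. when h is a quotient map.
module Submission where

open import Defs
open import Data.Nat using (ℕ; _≤_; zero; suc; _%_; _≡ᵇ_)
open import Function.Bundles using (_⇔_; mk⇔; Equivalence)

open import Algebra.Bundles using (CommutativeRing)
open import Data.Bool using (Bool; true; false; T; _∧_; _∨_; not; _xor_; if_then_else_)
open import Data.Bool.ListAction using (and)
open import Data.Bool.Properties
  using (T-∧; ∧-assoc; ∧-comm; ∧-identityʳ; xor-identityʳ; xor-∧-commutativeRing)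
import Data.Bool.Properties as Bool
open import Data.Empty using (⊥-elim)
open import Data.Fin using (Fin; zero; suc)
open import Data.Fin.Properties using () renaming (_≟_ to _≟ᶠ_)
open import Data.Fin.Subset using (Subset)
open import Data.List using (List; []; _∷_; map; _++_; foldr; allFin)
open import Data.List.Properties using (map-tabulate)
open import Data.List.Membership.Propositional.Properties using (∈-allFin)
import Data.List.Relation.Unary.All as All
open import Data.List.Relation.Unary.All.Properties using (all⁺; all⁻; tabulate⁺)
open import Data.List.Relation.Unary.Any.Properties using (any⁺; any⁻)
  renaming (tabulate⁺ to any-tabulate⁺; tabulate⁻ to any-tabulate⁻)
open import Data.Nat.ListAction using (sum)
open import Data.Product using (∃; _,_; _×_)
import Data.Product as Product
open import Data.Unit using (tt)
open import Data.Vec using (_∷_; []; lookup)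
open import Data.Vec.Properties using (≡-dec; lookup∘tabulate)
import Data.Vec.Functional as Vector
open import Function using (id; _∘_; const; _$_)
open import Relation.Binary.PropositionalEquality
open import Relation.Nullary.Decidable using (⌊_⌋; isYes≗does; toWitness; fromWitness)

private
  module XorRing = CommutativeRing xor-∧-commutativeRing

  variable
    A B : Set

open import Algebra.Properties.CommutativeSemigroup XorRing.+-commutativeSemigroup
  using (interchange)
open import Algebra.Properties.Group XorRing.+-group using (∙-cancelˡ)

-- Relies on suc (suc k) % 2 reducing to k % 2 definitionally (builtin mod-helper).
suc-%2≡ᵇ1 : ∀ k → (suc k % 2 ≡ᵇ 1) ≡ not (k % 2 ≡ᵇ 1)
suc-%2≡ᵇ1 zero          = refl
suc-%2≡ᵇ1 (suc zero)    = refl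
suc-%2≡ᵇ1 (suc (suc k)) = suc-%2≡ᵇ1 k

xorSum : List A → (A → Bool) → Bool
xorSum xs f = foldr _xor_ false (map f xs)

xorSum-cong : ∀ (xs : List A) {f g : A → Bool} → (∀ x → f x ≡ g x) → xorSum xs f ≡ xorSum xs g
xorSum-cong []       f≗g = refl
xorSum-cong (x ∷ xs) f≗g = cong₂ _xor_ (f≗g x) (xorSum-cong xs f≗g)

xorSum-false : ∀ (xs : List A) → xorSum xs (const false) ≡ false
xorSum-false []       = refl
xorSum-false (x ∷ xs) = xorSum-false xs

xorSum-++ : ∀ (xs ys : List A) f → xorSum (xs ++ ys) f ≡ xorSum xs f xor xorSum ys f
xorSum-++ []       ys f = refl
xorSum-++ (x ∷ xs) ys f =
  trans (cong (f x xor_) (xorSum-++ xs ys f)) (sym (Bool.xor-assoc (f x) _ _))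

xorSum-map : ∀ (xs : List B) (g : B → A) f → xorSum (map g xs) f ≡ xorSum xs (f ∘ g)
xorSum-map []       g f = refl
xorSum-map (x ∷ xs) g f = cong (f (g x) xor_) (xorSum-map xs g f)

xorSum-xor : ∀ (xs : List A) f g →
  xorSum xs (λ x → f x xor g x) ≡ xorSum xs f xor xorSum xs g
xorSum-xor []       f g = refl
xorSum-xor (x ∷ xs) f g =
  trans (cong ((f x xor g x) xor_) (xorSum-xor xs f g)) (interchange (f x) (g x) _ _)

∧-distribˡ-xorSum : ∀ (xs : List A) b f → b ∧ xorSum xs f ≡ xorSum xs (λ x → b ∧ f x)
∧-distribˡ-xorSum xs false f = sym (xorSum-false xs)
∧-distribˡ-xorSum xs true  f = refl

∧-distribʳ-xorSum : ∀ (xs : List A) b f → xorSum xs f ∧ b ≡ xorSum xs (λ x → f x ∧ b)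
∧-distribʳ-xorSum xs b f = begin
  xorSum xs f ∧ b             ≡⟨ ∧-comm (xorSum xs f) b ⟩
  b ∧ xorSum xs f             ≡⟨ ∧-distribˡ-xorSum xs b f ⟩
  xorSum xs (λ x → b ∧ f x)   ≡⟨ xorSum-cong xs (λ x → ∧-comm b (f x)) ⟩
  xorSum xs (λ x → f x ∧ b)   ∎
  where open ≡-Reasoning

xorSum-comm : ∀ (xs : List A) (ys : List B) (f : A → B → Bool) →
  xorSum xs (λ x → xorSum ys (f x)) ≡ xorSum ys (λ y → xorSum xs (λ x → f x y))
xorSum-comm []       ys f = sym (xorSum-false ys)
xorSum-comm (x ∷ xs) ys f =
  trans (cong (xorSum ys (f x) xor_) (xorSum-comm xs ys f))
        (sym (xorSum-xor ys (f x) (λ y → xorSum xs (λ x' → f x' y))))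

xorSum-parity : ∀ (xs : List A) (p : A → Bool) →
  (sum (map (λ x → if p x then 1 else 0) xs) % 2 ≡ᵇ 1) ≡ xorSum xs p
xorSum-parity []       p = refl
xorSum-parity (x ∷ xs) p with p x
... | true  = trans (suc-%2≡ᵇ1 (sum (map (λ x → if p x then 1 else 0) xs)))
                    (cong not (xorSum-parity xs p))
... | false = xorSum-parity xs p

xorSum-allSubsets-suc : ∀ n (f : Subset (suc n) → Bool) →
  xorSum (allSubsets (suc n)) f
    ≡ xorSum (allSubsets n) (f ∘ (false ∷_)) xor xorSum (allSubsets n) (f ∘ (true ∷_))
xorSum-allSubsets-suc n f =
  trans (xorSum-++ (map (false ∷_) (allSubsets n)) (map (true ∷_) (allSubsets n)) f)
        (cong₂ _xor_ (xorSum-map (allSubsets n) (false ∷_) f)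
                     (xorSum-map (allSubsets n) (true ∷_) f))

==ˢ-∷ : ∀ {n} b c (F E : Subset n) → ((b ∷ F) ==ˢ (c ∷ E)) ≡ ⌊ b Bool.≟ c ⌋ ∧ (F ==ˢ E)
==ˢ-∷ b c F E =
  trans (isYes≗does (≡-dec Bool._≟_ (b ∷ F) (c ∷ E)))
        (sym (cong₂ _∧_ (isYes≗does (b Bool.≟ c)) (isYes≗does (≡-dec Bool._≟_ F E))))

xorSum-allSubsets-==ˢ : ∀ n (F : Subset n) (g : Subset n → Bool) →
  xorSum (allSubsets n) (λ E → (F ==ˢ E) ∧ g E) ≡ g F
xorSum-allSubsets-==ˢ zero    []      g = xor-identityʳ (g [])
xorSum-allSubsets-==ˢ (suc n) (b ∷ F) g = begin
  xorSum (allSubsets (suc n)) (λ E → ((b ∷ F) ==ˢ E) ∧ g E)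
    ≡⟨ xorSum-allSubsets-suc n _ ⟩
  xorSum S (λ E → ((b ∷ F) ==ˢ (false ∷ E)) ∧ g (false ∷ E))
    xor xorSum S (λ E → ((b ∷ F) ==ˢ (true ∷ E)) ∧ g (true ∷ E))
    ≡⟨ cong₂ _xor_ (restrict false) (restrict true) ⟩
  (⌊ b Bool.≟ false ⌋ ∧ g (false ∷ F)) xor (⌊ b Bool.≟ true ⌋ ∧ g (true ∷ F))
    ≡⟨ select b ⟩
  g (b ∷ F) ∎
  where
  open ≡-Reasoning
  S : List (Subset n)
  S = allSubsets n

  restrict : ∀ c →
    xorSum S (λ E → ((b ∷ F) ==ˢ (c ∷ E)) ∧ g (c ∷ E)) ≡ ⌊ b Bool.≟ c ⌋ ∧ g (c ∷ F)
  restrict c = begin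
    xorSum S (λ E → ((b ∷ F) ==ˢ (c ∷ E)) ∧ g (c ∷ E))
      ≡⟨ xorSum-cong S (λ E → trans (cong (_∧ g (c ∷ E)) (==ˢ-∷ b c F E))
                                     (∧-assoc ⌊ b Bool.≟ c ⌋ (F ==ˢ E) (g (c ∷ E)))) ⟩
    xorSum S (λ E → ⌊ b Bool.≟ c ⌋ ∧ ((F ==ˢ E) ∧ g (c ∷ E)))
      ≡⟨ ∧-distribˡ-xorSum S _ _ ⟨
    ⌊ b Bool.≟ c ⌋ ∧ xorSum S (λ E → (F ==ˢ E) ∧ g (c ∷ E))
      ≡⟨ cong (⌊ b Bool.≟ c ⌋ ∧_) (xorSum-allSubsets-==ˢ n F (g ∘ (c ∷_))) ⟩
    ⌊ b Bool.≟ c ⌋ ∧ g (c ∷ F) ∎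

  select : ∀ b → (⌊ b Bool.≟ false ⌋ ∧ g (false ∷ F)) xor (⌊ b Bool.≟ true ⌋ ∧ g (true ∷ F))
                   ≡ g (b ∷ F)
  select false = xor-identityʳ (g (false ∷ F))
  select true  = refl

T-⇔⇒≡ : ∀ {x y} → (T x ⇔ T y) → x ≡ y
T-⇔⇒≡ {false} {false} _   = refl
T-⇔⇒≡ {false} {true}  x⇔y = ⊥-elim (Equivalence.from x⇔y tt)
T-⇔⇒≡ {true}  {false} x⇔y = ⊥-elim (Equivalence.to x⇔y tt)
T-⇔⇒≡ {true}  {true}  _   = refl

T-not-∨ : ∀ x {y} → T (not x ∨ y) ⇔ (T x → T y)
T-not-∨ false = mk⇔ (λ _ ()) (const tt)
T-not-∨ true  = mk⇔ const (_$ tt)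

T-monomial : ∀ {n} (E : Subset n) a → T (monomial E a) ⇔ (∀ i → T (lookup E i) → T (a i))
T-monomial {n} E a = mk⇔
  (λ t i → Equivalence.to (T-not-∨ (lookup E i)) (All.lookup (all⁺ p (allFin n) t) (∈-allFin i)))
  (λ E⊆a → all⁻ p (tabulate⁺ (λ i → Equivalence.from (T-not-∨ (lookup E i)) (E⊆a i))))
  where
  p : Fin n → Bool
  p i = not (lookup E i) ∨ a i

T-image : ∀ {m n} (h : Fin m → Fin n) E' i →
  T (lookup (image h E') i) ⇔ ∃ λ j → T (lookup E' j) × h j ≡ i
T-image {m} h E' i = mk⇔
  (λ t → Product.map₂ (Product.map₂ toWitness ∘ Equivalence.to T-∧)
           (any-tabulate⁻ (any⁻ p (allFin m) (subst T (lookup∘tabulate _ i) t))))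
  (λ { (j , E'j , refl) → subst T (sym (lookup∘tabulate _ i))
         (any⁺ p (any-tabulate⁺ j (Equivalence.from T-∧ (E'j , fromWitness refl)))) })
  where
  p : Fin m → Bool
  p j = lookup E' j ∧ ⌊ h j ≟ᶠ i ⌋

monomial-image : ∀ {m n} (h : Fin m → Fin n) E' (a : Fin n → Bool) →
  monomial E' (a ∘ h) ≡ monomial (image h E') a
monomial-image h E' a = T-⇔⇒≡ (mk⇔
  (λ t → Equivalence.from (T-monomial (image h E') a) λ i hE'i →
    let (j , E'j , hj≡i) = Equivalence.to (T-image h E' i) hE'i
    in subst (T ∘ a) hj≡i (Equivalence.to (T-monomial E' (a ∘ h)) t j E'j))
  (λ t → Equivalence.from (T-monomial E' (a ∘ h)) λ j E'j →
    Equivalence.to (T-monomial (image h E') a) t (h j)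
      (Equivalence.from (T-image h E' (h j)) (j , E'j , refl))))

monomial-∷ : ∀ {n} b (E : Subset n) a →
  monomial (b ∷ E) a ≡ (not b ∨ a zero) ∧ monomial E (a ∘ suc)
monomial-∷ {n} b E a = cong ((not b ∨ a zero) ∧_)
  (trans (cong and (map-tabulate suc p)) (sym (cong and (map-tabulate id (p ∘ suc)))))
  where
  p : Fin (suc n) → Bool
  p i = not (lookup (b ∷ E) i) ∨ a i

-- fH H is anf (edges H) definitionally.
anf : ∀ {n} → (Subset n → Bool) → (Fin n → Bool) → Bool
anf {n} c a = xorSum (allSubsets n) (λ E → c E ∧ monomial E a)

anf-cong : ∀ {n} {c d : Subset n → Bool} → (∀ E → c E ≡ d E) → ∀ a → anf c a ≡ anf d a
anf-cong {n} c≗d a = xorSum-cong (allSubsets n) (λ E → cong (_∧ monomial E a) (c≗d E))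

anf-[] : (c : Subset 0 → Bool) (a : Fin 0 → Bool) → anf c a ≡ c []
anf-[] c a = trans (xor-identityʳ (c [] ∧ true)) (∧-identityʳ (c []))

anf-suc : ∀ {n} (c : Subset (suc n) → Bool) a →
  anf c a ≡ anf (c ∘ (false ∷_)) (a ∘ suc) xor (a zero ∧ anf (c ∘ (true ∷_)) (a ∘ suc))
anf-suc {n} c a =
  trans (xorSum-allSubsets-suc n (λ E → c E ∧ monomial E a))
        (cong₂ _xor_ (xorSum-cong S (λ E → cong (c (false ∷ E) ∧_) (monomial-∷ false E a)))
                     (trans (xorSum-cong S pull-a₀) (sym (∧-distribˡ-xorSum S (a zero) _))))
  where
  S : List (Subset n)
  S = allSubsets n
  pull-a₀ : ∀ E → c (true ∷ E) ∧ monomial (true ∷ E) a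
                    ≡ a zero ∧ (c (true ∷ E) ∧ monomial E (a ∘ suc))
  pull-a₀ E rewrite monomial-∷ true E a =
    trans (sym (∧-assoc (c (true ∷ E)) (a zero) _))
          (trans (cong (_∧ monomial E (a ∘ suc)) (∧-comm (c (true ∷ E)) (a zero)))
                 (∧-assoc (a zero) (c (true ∷ E)) _))

anf-injective : ∀ n {c d : Subset n → Bool} → (∀ a → anf c a ≡ anf d a) → ∀ E → c E ≡ d E
anf-injective zero    {c} {d} c≗d [] =
  trans (sym (anf-[] c (λ ()))) (trans (c≗d (λ ())) (anf-[] d (λ ())))
anf-injective (suc n) {c} {d} c≗d (b ∷ E) = coefficient b
  where
  c₀ c₁ d₀ d₁ : Subset n → Bool
  c₀ = c ∘ (false ∷_)
  c₁ = c ∘ (true ∷_)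
  d₀ = d ∘ (false ∷_)
  d₁ = d ∘ (true ∷_)

  at : ∀ x a → anf c₀ a xor (x ∧ anf c₁ a) ≡ anf d₀ a xor (x ∧ anf d₁ a)
  at x a = trans (sym (anf-suc c (x Vector.∷ a)))
                 (trans (c≗d (x Vector.∷ a)) (anf-suc d (x Vector.∷ a)))

  c₀≗d₀ : ∀ a → anf c₀ a ≡ anf d₀ a
  c₀≗d₀ a = trans (sym (xor-identityʳ _)) (trans (at false a) (xor-identityʳ _))

  c₁≗d₁ : ∀ a → anf c₁ a ≡ anf d₁ a
  c₁≗d₁ a = ∙-cancelˡ (anf c₀ a) _ _ (trans (at true a) (cong (_xor anf d₁ a) (sym (c₀≗d₀ a))))

  coefficient : ∀ b → c (b ∷ E) ≡ d (b ∷ E)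
  coefficient false = anf-injective n c₀≗d₀ E
  coefficient true  = anf-injective n c₁≗d₁ E

quotient : ∀ {m n} → Hypergraph m → (Fin m → Fin n) → Hypergraph n
quotient H' h .edges E = countPreimages H' h E % 2 ≡ᵇ 1

fH-quotient : ∀ {m n} (H' : Hypergraph m) (h : Fin m → Fin n) a →
  fH H' (a ∘ h) ≡ fH (quotient H' h) a
fH-quotient {m} {n} H' h a = begin
  fH H' (a ∘ h)
    ≡⟨ xorSum-cong S' (λ E' → cong (e E' ∧_) (monomial-image h E' a)) ⟩
  xorSum S' (λ E' → e E' ∧ monomial (image h E') a)
    ≡⟨ xorSum-cong S' (λ E' → xorSum-allSubsets-==ˢ n (image h E') (λ E → e E' ∧ monomial E a)) ⟨
  xorSum S' (λ E' → xorSum S (λ E → (image h E' ==ˢ E) ∧ (e E' ∧ monomial E a)))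
    ≡⟨ xorSum-comm S' S _ ⟩
  xorSum S (λ E → xorSum S' (λ E' → (image h E' ==ˢ E) ∧ (e E' ∧ monomial E a)))
    ≡⟨ xorSum-cong S (λ E → xorSum-cong S' (λ E' → regroup (image h E' ==ˢ E) (e E') _)) ⟩
  xorSum S (λ E → xorSum S' (λ E' → (e E' ∧ (image h E' ==ˢ E)) ∧ monomial E a))
    ≡⟨ xorSum-cong S (λ E → ∧-distribʳ-xorSum S' (monomial E a) _) ⟨
  xorSum S (λ E → xorSum S' (λ E' → e E' ∧ (image h E' ==ˢ E)) ∧ monomial E a)
    ≡⟨ xorSum-cong S (λ E → cong (_∧ monomial E a) (xorSum-parity S' _)) ⟨
  fH (quotient H' h) a ∎
  where
  open ≡-Reasoning
  S : List (Subset n)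
  S = allSubsets n
  S' : List (Subset m)
  S' = allSubsets m
  e : Subset m → Bool
  e = edges H'
  regroup : ∀ x y z → x ∧ (y ∧ z) ≡ (y ∧ x) ∧ z
  regroup x y z = trans (sym (∧-assoc x y z)) (cong (_∧ z) (∧-comm x y))

theorem3p5 : (n m : ℕ) → 1 ≤ n → 1 ≤ m →
    (H : Hypergraph n) (H' : Hypergraph m) →
    (H ⪯ H') ⇔ (fH H ≤ᶠ fH H')
theorem3p5 n m _ _ H H' = mk⇔
  (λ (h , H≡H'/h) → h , λ a → trans (anf-cong H≡H'/h a) (sym (fH-quotient H' h a)))
  (λ (σ , fH≡fH'∘σ) → σ , anf-injective n (λ a → trans (fH≡fH'∘σ a) (fH-quotient H' σ a)))
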